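{- Let $s,t$ be integers with $1\leqslant s\leqslant t$, and let $h$ be an integer with $0\leqslant h\leqslant s$. Then $$\kappa^{(h)}(EH(s,t))\leqslant 2^h(s+1-h)\quad\text{and}\quad\lambda^{(h)}(EH(s,t))\leqslant 2^h(s+1-h).$$ In particular, $EH(s,t)$ has an $h$-vertex-cut and an $h$-edge-cut.
   Context: For integers $s,t\geqslant 1$, the exchanged hypercube $EH(s,t)$ is the graph whose vertices are the binary strings $u=u_{s+t}u_{s+t-1}\cdots u_1u_0$ of length $s+t+1$. Two vertices $u,v$ are adjacent if and only if one of the following three conditions holds: (i) $u$ and $v$ differ exactly in the last bit $u_0$; (ii) $u$ and $v$ differ in exactly one bit $u_r$ with $1\leqslant r\leqslant t$, and $u_0=v_0=1$; (iii) $u$ and $v$ differ in exactly one bit $u_r$ with $t+1\leqslant r\leqslant s+t$, and $u_0=v_0=0$. For a connected graph $G$ and an integer $h\geqslant 0$: - A vertex subset $S\subset V(G)$ is an $h$-vertex-cut if $G-S$ is disconnected and every vertex of $G-S$ has degree at least $h$ in $G-S$. - An edge subset $F\subset E(G)$ is an $h$-edge-cut if $G-F$ is disconnected and every vertex of $G-F$ has degree at least $h$ in $G-F$. - $\kappa^{(h)}(G)$ is the minimum cardinality of an $h$-vertex-cut of $G$. - $\lambda^{(h)}(G)$ is the minimum cardinality of an $h$-edge-cut of $G$. -}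

module Defs where

open import Data.Nat using (ℕ; zero; suc; _+_; _*_; _∸_; _^_; _≤_)
open import Data.Bool using (Bool; true; false)
open import Data.Fin using (Fin; toℕ)
import Data.Fin as Fin
open import Data.Vec using (Vec; lookup)
open import Data.List using (List; length)
open import Data.List.Membership.Propositional using (_∈_)
open import Data.List.Relation.Unary.All using (All)
open import Data.List.Relation.Unary.Unique.Propositional using (Unique)
open import Data.List.Relation.Unary.AllPairs using (AllPairs)
open import Data.Product using (Σ; ∃; _×_; _,_)
open import Data.Sum using (_⊎_)
open import Relation.Binary.PropositionalEquality using (_≡_; _≢_)
open import Relation.Nullary using (¬_)

-- A vertex u = u_{s+t} ... u_1 u_0 is a bit vector of length s+t+1;
-- bit u_r is  lookup u r  (index r : Fin (s+t+1), r = 0 is the last bit).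
EHVertex : ℕ → ℕ → Set
EHVertex s t = Vec Bool (suc (s + t))

DifferExactlyAt : ∀ {n} → Vec Bool n → Vec Bool n → Fin n → Set
DifferExactlyAt u v r = (lookup u r ≢ lookup v r) × (∀ i → i ≢ r → lookup u i ≡ lookup v i)

EHAdj : (s t : ℕ) → EHVertex s t → EHVertex s t → Set
EHAdj s t u v = ∃ λ (r : Fin (suc (s + t))) → DifferExactlyAt u v r ×
  ( (toℕ r ≡ 0)
  ⊎ ((1 ≤ toℕ r × toℕ r ≤ t) × lookup u Fin.zero ≡ true × lookup v Fin.zero ≡ true)
  ⊎ ((suc t ≤ toℕ r × toℕ r ≤ s + t) × lookup u Fin.zero ≡ false × lookup v Fin.zero ≡ false))

data Path {V : Set} (E : V → V → Set) : V → V → Set where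
  here  : ∀ {u} → Path E u u
  step  : ∀ {u v w} → E u v → Path E v w → Path E u w

DegreeAtLeast : {V : Set} → (V → V → Set) → ℕ → V → Set
DegreeAtLeast {V} E h u = ∃ λ (L : List V) → length L ≡ h × Unique L × All (E u) L

DelVerts : {V : Set} → (V → V → Set) → List V → V → V → Set
DelVerts Adj S u v = Adj u v × ¬ (u ∈ S) × ¬ (v ∈ S)

IsHVertexCut : {V : Set} → (V → V → Set) → ℕ → List V → Set
IsHVertexCut {V} Adj h S =
  Unique S ×
  (∃ λ (u : V) → ∃ λ (v : V) → ¬ (u ∈ S) × ¬ (v ∈ S) × ¬ Path (DelVerts Adj S) u v) ×
  (∀ (u : V) → ¬ (u ∈ S) → DegreeAtLeast (DelVerts Adj S) h u)

-- edge sets are lists of ordered pairs, each an edge; a pair (u,v)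
-- represents the unordered edge {u,v}
SameEdge : {V : Set} → V × V → V × V → Set
SameEdge (u , v) (u' , v') = ((u ≡ u') × (v ≡ v')) ⊎ ((u ≡ v') × (v ≡ u'))

EdgeIn : {V : Set} → List (V × V) → V → V → Set
EdgeIn F u v = ((u , v) ∈ F) ⊎ ((v , u) ∈ F)

DelEdges : {V : Set} → (V → V → Set) → List (V × V) → V → V → Set
DelEdges Adj F u v = Adj u v × ¬ EdgeIn F u v

IsHEdgeCut : {V : Set} → (V → V → Set) → ℕ → List (V × V) → Set
IsHEdgeCut {V} Adj h F =
  All (λ e → Adj (Data.Product.proj₁ e) (Data.Product.proj₂ e)) F ×
  AllPairs (λ e e' → ¬ SameEdge e e') F ×
  (∃ λ (u : V) → ∃ λ (v : V) → ¬ Path (DelEdges Adj F) u v) ×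
  (∀ (u : V) → DegreeAtLeast (DelEdges Adj F) h u)

KappaH≤ : {V : Set} → (V → V → Set) → ℕ → ℕ → Set
KappaH≤ {V} Adj h b = ∃ λ (S : List V) → IsHVertexCut Adj h S × length S ≤ b

LambdaH≤ : {V : Set} → (V → V → Set) → ℕ → ℕ → Set
LambdaH≤ {V} Adj h b = ∃ λ (F : List (V × V)) → IsHEdgeCut Adj h F × length F ≤ b

-- Let m = t + (s - h), so that exactly h bits lie above m, and let W be the 2^h vertices
-- vanishing on bits 0, …, m.  From a vertex of W, an edge through bit r in 1, …, t needs
-- u_0 = 1 and an edge through a bit above m stays in W; the only edges leaving W go through
-- the s + 1 - h "bridge" bits 0 and t + 1, …, m.  Deleting the bridge neighbours of W (resp.
-- the bridge edges of W) therefore separates W from the unit vector at bit 1, at a cost of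
-- 2^h (s + 1 - h).  For the degree condition: a vertex with u_0 = 0 keeps its h neighbours
-- through the bits above m, and one with u_0 = 1 keeps at least t ≥ h neighbours through
-- bits 0, …, t, because a bridge neighbour of W has exactly one set bit among 0, …, m and
-- that bit is a bridge.
module Submission where

open import Defs
open import Data.Nat using (ℕ; zero; suc; _≟_; _+_; _*_; _∸_; _^_; _≤_; _<_; z≤n; s≤s; z<s; s<s; _≤?_; s≤s⁻¹)
open import Data.Nat.Properties
open import Data.Bool using (Bool; true; false; not)
open import Data.Bool.Properties using (not-involutive; not-¬; ¬-not)
open import Data.Fin using (Fin; toℕ; fromℕ<)
import Data.Fin as Fin
open import Data.Fin.Properties using (toℕ-fromℕ<; toℕ-injective; toℕ<n; any?)
open import Data.Vec using (Vec; []; _∷_; lookup; updateAt; replicate)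
open import Data.Vec.Properties using (lookup∘updateAt; lookup∘updateAt′; updateAt-updateAt-local; updateAt-id; updateAt-commutes; tabulate∘lookup; tabulate-cong; lookup-replicate)
import Data.Vec.Properties as Vec
import Data.Bool.Properties as Bool
open import Data.List using (List; []; _∷_; [_]; length; map; take; filter; deduplicate; cartesianProductWith)
open import Data.List.Properties using (length-++; length-map; length-take; length-deduplicate; filter-all)
open import Data.List.Membership.Propositional using (_∈_; _∉_)
open import Data.List.Membership.Propositional.Properties using (∈-map⁺; ∈-map⁻; ∈-filter⁻; ∈-cartesianProductWith⁺; ∈-cartesianProductWith⁻; ∈-deduplicate⁺; ∈-deduplicate⁻)
open import Data.List.Relation.Unary.Any using (here; there)
open import Data.List.Relation.Unary.All as All using (All; []; _∷_)
import Data.List.Relation.Unary.All.Properties as All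
open import Data.List.Relation.Unary.AllPairs using (AllPairs; []; _∷_)
open import Data.List.Relation.Unary.Unique.Propositional using (Unique)
import Data.List.Relation.Unary.Unique.Propositional.Properties as Unique
open import Data.List.Relation.Unary.Unique.DecPropositional.Properties using (deduplicate-!)
open import Data.Product using (_×_; _,_; proj₁; proj₂; ∃; ∃₂)
open import Data.Product.Properties using (≡-dec; ,-injective)
open import Data.Sum using (_⊎_; inj₁; inj₂)
open import Function using (_∘_)
open import Relation.Binary.Definitions using (DecidableEquality)
open import Relation.Nullary using (¬_; yes; no; contradiction; ¬?; _×-dec_)
open import Relation.Binary.PropositionalEquality using (_≡_; _≢_; refl; sym; trans; cong; cong₂; subst; module ≡-Reasoning)

lookup-extensionality : ∀ {A : Set} {N} {u v : Vec A N} → (∀ i → lookup u i ≡ lookup v i) → u ≡ v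
lookup-extensionality {u = u} {v} eq =
  trans (sym (tabulate∘lookup u)) (trans (tabulate-cong eq) (tabulate∘lookup v))

flipBit : ∀ {N} → Vec Bool N → Fin N → Vec Bool N
flipBit u r = updateAt u r not

module _ {N : ℕ} where

  lookup-flipBit : (u : Vec Bool N) (r : Fin N) → lookup (flipBit u r) r ≡ not (lookup u r)
  lookup-flipBit u r = lookup∘updateAt r u

  lookup-flipBit-≢ : (u : Vec Bool N) {r i : Fin N} → i ≢ r → lookup (flipBit u r) i ≡ lookup u i
  lookup-flipBit-≢ u {r} {i} i≢r = lookup∘updateAt′ i r i≢r u

  flipBit-involutive : (u : Vec Bool N) (r : Fin N) → flipBit (flipBit u r) r ≡ u
  flipBit-involutive u r = trans (updateAt-updateAt-local r u (not-involutive _)) (updateAt-id r u)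

  flipBit-comm : (u : Vec Bool N) (a b : Fin N) → flipBit (flipBit u a) b ≡ flipBit (flipBit u b) a
  flipBit-comm u a b with a Fin.≟ b
  ... | yes refl = refl
  ... | no a≢b   = updateAt-commutes b a (a≢b ∘ sym) u

  flipBit-injective : (u : Vec Bool N) {a b : Fin N} → flipBit u a ≡ flipBit u b → a ≡ b
  flipBit-injective u {a} {b} eq with a Fin.≟ b
  ... | yes a≡b = a≡b
  ... | no a≢b  = contradiction (sym not-ua≡ua) (not-¬ refl)
    where
    open ≡-Reasoning
    not-ua≡ua : not (lookup u a) ≡ lookup u a
    not-ua≡ua = begin
      not (lookup u a)          ≡⟨ lookup-flipBit u a ⟨
      lookup (flipBit u a) a    ≡⟨ cong (λ v → lookup v a) eq ⟩
      lookup (flipBit u b) a    ≡⟨ lookup-flipBit-≢ u a≢b ⟩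
      lookup u a                ∎

  differExactlyAt-flipBit : (u : Vec Bool N) (r : Fin N) → DifferExactlyAt u (flipBit u r) r
  differExactlyAt-flipBit u r =
    (λ eq → not-¬ refl (trans eq (lookup-flipBit u r))) , λ i i≢r → sym (lookup-flipBit-≢ u i≢r)

  differExactlyAt⇒flipBit : {u v : Vec Bool N} {r : Fin N} → DifferExactlyAt u v r → v ≡ flipBit u r
  differExactlyAt⇒flipBit {u} {v} {r} (differ , agree) = lookup-extensionality pointwise
    where
    pointwise : ∀ i → lookup v i ≡ lookup (flipBit u r) i
    pointwise i with i Fin.≟ r
    ... | yes refl = trans (¬-not (differ ∘ sym)) (sym (lookup-flipBit u r))
    ... | no i≢r   = trans (sym (agree i i≢r)) (sym (lookup-flipBit-≢ u i≢r))

length-cartesianProductWith : ∀ {A B C : Set} (f : A → B → C) (xs : List A) (ys : List B) →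
  length (cartesianProductWith f xs ys) ≡ length xs * length ys
length-cartesianProductWith f []       ys = refl
length-cartesianProductWith f (x ∷ xs) ys =
  trans (length-++ (map (f x) ys))
        (cong₂ _+_ (length-map (f x) ys) (length-cartesianProductWith f xs ys))

ZeroBelow : ∀ {N} → ℕ → Vec Bool N → Set
ZeroBelow k u = ∀ i → toℕ i < k → lookup u i ≡ false

zeroBelowVectors : (k N : ℕ) → List (Vec Bool N)
zeroBelowVectors k       zero    = [ [] ]
zeroBelowVectors zero    (suc N) = cartesianProductWith _∷_ (false ∷ true ∷ []) (zeroBelowVectors zero N)
zeroBelowVectors (suc k) (suc N) = map (false ∷_) (zeroBelowVectors k N)

length-zeroBelowVectors : ∀ k N → length (zeroBelowVectors k N) ≡ 2 ^ (N ∸ k)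
length-zeroBelowVectors zero    zero    = refl
length-zeroBelowVectors (suc k) zero    = refl
length-zeroBelowVectors zero    (suc N) =
  trans (length-cartesianProductWith _∷_ (false ∷ true ∷ []) (zeroBelowVectors zero N))
        (cong (2 *_) (length-zeroBelowVectors zero N))
length-zeroBelowVectors (suc k) (suc N) =
  trans (length-map (false ∷_) (zeroBelowVectors k N)) (length-zeroBelowVectors k N)

∈-zeroBelowVectors⁺ : ∀ k {N} {u : Vec Bool N} → ZeroBelow k u → u ∈ zeroBelowVectors k N
∈-zeroBelowVectors⁺ k       {u = []}        _ = here refl
∈-zeroBelowVectors⁺ zero    {u = false ∷ u} _ =
  ∈-cartesianProductWith⁺ _∷_ {xs = false ∷ true ∷ []} (here refl) (∈-zeroBelowVectors⁺ zero λ _ ())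
∈-zeroBelowVectors⁺ zero    {u = true ∷ u}  _ =
  ∈-cartesianProductWith⁺ _∷_ {xs = false ∷ true ∷ []} (there (here refl)) (∈-zeroBelowVectors⁺ zero λ _ ())
∈-zeroBelowVectors⁺ (suc k) {u = x ∷ u} zero-below with zero-below Fin.zero z<s
... | refl = ∈-map⁺ (false ∷_) (∈-zeroBelowVectors⁺ k λ i i<k → zero-below (Fin.suc i) (s<s i<k))

∈-zeroBelowVectors⁻ : ∀ k {N} {u : Vec Bool N} → u ∈ zeroBelowVectors k N → ZeroBelow k u
∈-zeroBelowVectors⁻ zero    _ _ ()
∈-zeroBelowVectors⁻ (suc k) {suc N} u∈ with ∈-map⁻ (false ∷_) u∈
... | u , u∈′ , refl = zero-below
  where
  zero-below : ZeroBelow (suc k) (false ∷ u)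
  zero-below Fin.zero    _         = refl
  zero-below (Fin.suc i) (s<s i<k) = ∈-zeroBelowVectors⁻ k u∈′ i i<k

interval : ∀ {n} (a k : ℕ) → a + k ≤ n → List (Fin n)
interval a zero    _       = []
interval {n} a (suc k) a+k≤n =
  fromℕ< (<-≤-trans (m<m+n a z<s) a+k≤n) ∷ interval (suc a) k (subst (_≤ n) (+-suc a k) a+k≤n)

module _ {n : ℕ} where

  length-interval : ∀ a k (a+k≤n : a + k ≤ n) → length (interval a k a+k≤n) ≡ k
  length-interval a zero    _     = refl
  length-interval a (suc k) a+k≤n = cong suc (length-interval (suc a) k _)

  ∈-interval⁻ : ∀ a k (a+k≤n : a + k ≤ n) {r} → r ∈ interval a k a+k≤n → a ≤ toℕ r × toℕ r < a + k
  ∈-interval⁻ a (suc k) a+k≤n (here refl) =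
    ≤-reflexive (sym (toℕ-fromℕ< _)) , subst (_< a + suc k) (sym (toℕ-fromℕ< _)) (m<m+n a z<s)
  ∈-interval⁻ a (suc k) a+k≤n {r} (there r∈) with ∈-interval⁻ (suc a) k _ r∈
  ... | a<r , r<a+k = <⇒≤ a<r , subst (toℕ r <_) (sym (+-suc a k)) r<a+k

  ∈-interval⁺ : ∀ a k (a+k≤n : a + k ≤ n) {r} → a ≤ toℕ r → toℕ r < a + k → r ∈ interval a k a+k≤n
  ∈-interval⁺ a zero    _     {r} a≤r r<a = contradiction a≤r (<⇒≱ (subst (toℕ r <_) (+-identityʳ a) r<a))
  ∈-interval⁺ a (suc k) a+k≤n {r} a≤r r<a+k with toℕ r ≟ a
  ... | yes r≡a = here (toℕ-injective (trans r≡a (sym (toℕ-fromℕ< _))))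
  ... | no r≢a  = there (∈-interval⁺ (suc a) k _ (≤∧≢⇒< a≤r (r≢a ∘ sym)) (subst (toℕ r <_) (+-suc a k) r<a+k))

  interval-unique : ∀ a k (a+k≤n : a + k ≤ n) → Unique (interval a k a+k≤n)
  interval-unique a zero    _     = []
  interval-unique a (suc k) a+k≤n = All.tabulate head≢ ∷ interval-unique (suc a) k _
    where
    head≢ : ∀ {r} → r ∈ interval (suc a) k _ → fromℕ< _ ≢ r
    head≢ r∈ refl = 1+n≰n (subst (suc a ≤_) (toℕ-fromℕ< _) (proj₁ (∈-interval⁻ (suc a) k _ r∈)))

module _ {A : Set} (_≟ₐ_ : DecidableEquality A) where

  without : A → List A → List A
  without q = filter (λ x → ¬? (x ≟ₐ q))

  ∈-without⁻ : ∀ {q x} xs → x ∈ without q xs → x ∈ xs × x ≢ q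
  ∈-without⁻ {q} xs = ∈-filter⁻ (λ x → ¬? (x ≟ₐ q)) {xs = xs}

  without-unique : ∀ q {xs} → Unique xs → Unique (without q xs)
  without-unique q = Unique.filter⁺ (λ x → ¬? (x ≟ₐ q))

  length-without : ∀ q {xs} → Unique xs → length xs ≤ suc (length (without q xs))
  length-without q {[]}     _              = z≤n
  length-without q {x ∷ xs} (x∉xs ∷ xs!) with x ≟ₐ q
  ... | yes refl = s≤s (≤-reflexive (cong length (sym (filter-all (λ y → ¬? (y ≟ₐ x)) (All.map (_∘ sym) x∉xs)))))
  ... | no _     = s≤s (length-without q xs!)

Path-preserves : ∀ {V : Set} {E : V → V → Set} (P : V → Set) →
  (∀ {u v} → E u v → P u → P v) → ∀ {u v} → Path E u v → P u → P v
Path-preserves P closed here       pu = pu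
Path-preserves P closed (step e p) pu = Path-preserves P closed p (closed e pu)

DegreeAtLeast-fromInjection : ∀ {A V : Set} {E : V → V → Set} {h : ℕ} {u : V} (g : A → V) →
  (∀ {a b} → g a ≡ g b → a ≡ b) → (R : List A) → Unique R → h ≤ length R →
  (∀ {a} → a ∈ R → E u (g a)) → DegreeAtLeast E h u
DegreeAtLeast-fromInjection {h = h} g g-injective R R! h≤|R| adjacent =
    take h (map g R)
  , trans (length-take h (map g R)) (m≤n⇒m⊓n≡m (subst (h ≤_) (sym (length-map g R)) h≤|R|))
  , Unique.take⁺ h (Unique.map⁺ g-injective R!)
  , All.take⁺ h (All.map⁺ (All.tabulate adjacent))

outgoing⇒¬SameEdge : ∀ {V : Set} (P : V → Set) {xs : List (V × V)} →
  All (λ e → P (proj₁ e) × ¬ P (proj₂ e)) xs → AllPairs _≢_ xs → AllPairs (λ e e′ → ¬ SameEdge e e′) xs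
outgoing⇒¬SameEdge P []                   []          = []
outgoing⇒¬SameEdge P {x ∷ xs} (out ∷ outs) (x≢ ∷ xs!) =
  All.tabulate (λ y∈ → ¬same out (All.lookup outs y∈) (All.lookup x≢ y∈)) ∷ outgoing⇒¬SameEdge P outs xs!
  where
  ¬same : ∀ {x y} → P (proj₁ x) × ¬ P (proj₂ x) → P (proj₁ y) × ¬ P (proj₂ y) → x ≢ y → ¬ SameEdge x y
  ¬same _ _ x≢y (inj₁ (refl , refl)) = x≢y refl
  ¬same (px , _) (_ , ¬py) _ (inj₂ (refl , _)) = ¬py px

positive⇒≢zero : ∀ {n} {r : Fin (suc n)} → 1 ≤ toℕ r → Fin.zero ≢ r
positive⇒≢zero {r = Fin.zero} () _

module _ {s t : ℕ} (u : EHVertex s t) {r : Fin (suc (s + t))} where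

  EHAdj-flipBit₀ : toℕ r ≡ 0 → EHAdj s t u (flipBit u r)
  EHAdj-flipBit₀ r≡0 = r , differExactlyAt-flipBit u r , inj₁ r≡0

  EHAdj-flipBit-low : lookup u Fin.zero ≡ true → 1 ≤ toℕ r → toℕ r ≤ t → EHAdj s t u (flipBit u r)
  EHAdj-flipBit-low u₀ 1≤r r≤t = r , differExactlyAt-flipBit u r ,
    inj₂ (inj₁ ((1≤r , r≤t) , u₀ , trans (lookup-flipBit-≢ u (positive⇒≢zero 1≤r)) u₀))

  EHAdj-flipBit-high : lookup u Fin.zero ≡ false → t < toℕ r → EHAdj s t u (flipBit u r)
  EHAdj-flipBit-high u₀ t<r = r , differExactlyAt-flipBit u r ,
    inj₂ (inj₂ ((t<r , s≤s⁻¹ (toℕ<n r)) , u₀ ,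
      trans (lookup-flipBit-≢ u (positive⇒≢zero (≤-trans (s≤s z≤n) t<r))) u₀))

module Construction (s t h : ℕ) (1≤s : 1 ≤ s) (s≤t : s ≤ t) (h≤s : h ≤ s) where

  V : Set
  V = EHVertex s t

  Pos : Set
  Pos = Fin (suc (s + t))

  m : ℕ
  m = t + (s ∸ h)

  m+h≡s+t : m + h ≡ s + t
  m+h≡s+t = trans (+-assoc t (s ∸ h) h) (trans (cong (t +_) (m∸n+n≡m h≤s)) (+-comm t s))

  t≤m : t ≤ m
  t≤m = m≤m+n t (s ∸ h)

  m≤s+t : m ≤ s + t
  m≤s+t = ≤-trans (m≤m+n m h) (≤-reflexive m+h≡s+t)

  1≤t : 1 ≤ t
  1≤t = ≤-trans 1≤s s≤t

  h≤t : h ≤ t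
  h≤t = ≤-trans h≤s s≤t

  Low : V → Set
  Low = ZeroBelow (suc m)

  Bridge : Pos → Set
  Bridge r = toℕ r ≡ 0 ⊎ (t < toℕ r × toℕ r ≤ m)

  Bridge⇒≤m : ∀ {r} → Bridge r → toℕ r ≤ m
  Bridge⇒≤m (inj₁ r≡0)      = subst (_≤ m) (sym r≡0) z≤n
  Bridge⇒≤m (inj₂ (_ , r≤m)) = r≤m

  ¬Bridge-low : ∀ {r} → 1 ≤ toℕ r → toℕ r ≤ t → ¬ Bridge r
  ¬Bridge-low 1≤r _   (inj₁ r≡0)      = 1+n≰n (subst (1 ≤_) r≡0 1≤r)
  ¬Bridge-low _   r≤t (inj₂ (t<r , _)) = <⇒≱ t<r r≤t

  ¬Bridge-high : ∀ {r} → m < toℕ r → ¬ Bridge r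
  ¬Bridge-high m<r bridge = <⇒≱ m<r (Bridge⇒≤m bridge)

  bridges : List Pos
  bridges = Fin.zero ∷ interval (suc t) (s ∸ h) (s≤s m≤s+t)

  ∈-bridges⁺ : ∀ {r} → Bridge r → r ∈ bridges
  ∈-bridges⁺ (inj₁ r≡0)        = here (toℕ-injective r≡0)
  ∈-bridges⁺ (inj₂ (t<r , r≤m)) = there (∈-interval⁺ (suc t) (s ∸ h) _ t<r (s≤s r≤m))

  ∈-bridges⁻ : ∀ {r} → r ∈ bridges → Bridge r
  ∈-bridges⁻ (here refl) = inj₁ refl
  ∈-bridges⁻ (there r∈) with ∈-interval⁻ (suc t) (s ∸ h) _ r∈
  ... | t<r , r<1+m = inj₂ (t<r , s≤s⁻¹ r<1+m)

  lows : List V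
  lows = zeroBelowVectors (suc m) (suc (s + t))

  length-lows*bridges : length lows * length bridges ≡ 2 ^ h * (s + 1 ∸ h)
  length-lows*bridges = cong₂ _*_ length-lows length-bridges
    where
    length-lows : length lows ≡ 2 ^ h
    length-lows = trans (length-zeroBelowVectors (suc m) (suc (s + t)))
      (cong (2 ^_) (trans (cong (_∸ m) (sym m+h≡s+t)) (m+n∸m≡n m h)))
    length-bridges : length bridges ≡ s + 1 ∸ h
    length-bridges = trans (cong suc (length-interval (suc t) (s ∸ h) _))
      (sym (trans (+-∸-comm 1 h≤s) (+-comm (s ∸ h) 1)))

  lookup-flipBit-low : ∀ (u : V) {r} → Low u → toℕ r ≤ m → lookup (flipBit u r) r ≡ true
  lookup-flipBit-low u {r} low r≤m = trans (lookup-flipBit u r) (cong not (low r (s≤s r≤m)))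

  ¬Low-flipBit-low : ∀ (u : V) {r} → Low u → toℕ r ≤ m → ¬ Low (flipBit u r)
  ¬Low-flipBit-low u {r} low r≤m low′ =
    contradiction (trans (sym (lookup-flipBit-low u low r≤m)) (low′ r (s≤s r≤m))) λ ()

  Low-flipBit-high : ∀ (u : V) {r} → Low u → m < toℕ r → Low (flipBit u r)
  Low-flipBit-high u {r} low m<r i i≤m with i Fin.≟ r
  ... | yes refl = contradiction (s≤s⁻¹ i≤m) (<⇒≱ m<r)
  ... | no i≢r   = trans (lookup-flipBit-≢ u i≢r) (low i i≤m)

  EHAdj-flipBit-bridge : ∀ {w r} → Low w → Bridge r → EHAdj s t w (flipBit w r)
  EHAdj-flipBit-bridge {w} low (inj₁ r≡0)      = EHAdj-flipBit₀ w r≡0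
  EHAdj-flipBit-bridge {w} low (inj₂ (t<r , _)) = EHAdj-flipBit-high w (low Fin.zero z<s) t<r

  Low-edge : ∀ {u v} → Low u → EHAdj s t u v → (∃ λ r → Bridge r × v ≡ flipBit u r) ⊎ Low v
  Low-edge {u} {v} low (r , differ , kind) with differExactlyAt⇒flipBit {u = u} {v} differ
  ... | refl with kind
  ... | inj₁ r≡0 = inj₁ (r , inj₁ r≡0 , refl)
  ... | inj₂ (inj₁ (_ , u₀ , _)) = contradiction (trans (sym u₀) (low Fin.zero z<s)) λ ()
  ... | inj₂ (inj₂ ((t<r , _) , _)) with toℕ r ≤? m
  ...   | yes r≤m = inj₁ (r , inj₂ (t<r , r≤m) , refl)
  ...   | no r≰m  = inj₂ (Low-flipBit-high u low (≰⇒> r≰m))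

  degreeByFlips : ∀ {E : V → V → Set} {u} (R : List Pos) → Unique R → h ≤ length R →
    (∀ {r} → r ∈ R → E u (flipBit u r)) → DegreeAtLeast E h u
  degreeByFlips {E} {u} = DegreeAtLeast-fromInjection {E = E} {u = u} (flipBit u) (flipBit-injective u)

  highPositions : List Pos
  highPositions = interval (suc m) h (s≤s (≤-reflexive m+h≡s+t))

  lowPositions : List Pos
  lowPositions = interval 1 t (s≤s (≤-trans t≤m m≤s+t))

  highPositions-unique : Unique highPositions
  highPositions-unique = interval-unique _ _ _

  lowPositions-unique : Unique lowPositions
  lowPositions-unique = interval-unique _ _ _

  h≤length-highPositions : h ≤ length highPositions
  h≤length-highPositions = ≤-reflexive (sym (length-interval _ _ _))

  h≤length-lowPositions : h ≤ length lowPositions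
  h≤length-lowPositions = ≤-trans h≤t (≤-reflexive (sym (length-interval _ _ _)))

  ∈-highPositions⁻ : ∀ {r} → r ∈ highPositions → m < toℕ r
  ∈-highPositions⁻ r∈ = proj₁ (∈-interval⁻ _ _ _ r∈)

  ∈-lowPositions⁻ : ∀ {r} → r ∈ lowPositions → 1 ≤ toℕ r × toℕ r ≤ t
  ∈-lowPositions⁻ r∈ with ∈-interval⁻ _ _ _ r∈
  ... | 1≤r , r<1+t = 1≤r , s≤s⁻¹ r<1+t

  module _ {X : Set} (_≟ₓ_ : DecidableEquality X) (f : V → Pos → X) where

    lowBridgeImage : List X
    lowBridgeImage = deduplicate _≟ₓ_ (cartesianProductWith f lows bridges)

    ∈-lowBridgeImage⁺ : ∀ {w r} → Low w → Bridge r → f w r ∈ lowBridgeImage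
    ∈-lowBridgeImage⁺ low bridge = ∈-deduplicate⁺ _≟ₓ_
      (∈-cartesianProductWith⁺ f (∈-zeroBelowVectors⁺ (suc m) low) (∈-bridges⁺ bridge))

    ∈-lowBridgeImage⁻ : ∀ {x} → x ∈ lowBridgeImage → ∃₂ λ w r → Low w × Bridge r × x ≡ f w r
    ∈-lowBridgeImage⁻ x∈ with ∈-cartesianProductWith⁻ f lows bridges (∈-deduplicate⁻ _≟ₓ_ _ x∈)
    ... | w , r , w∈ , r∈ , refl = w , r , ∈-zeroBelowVectors⁻ (suc m) w∈ , ∈-bridges⁻ r∈ , refl

    length-lowBridgeImage : length lowBridgeImage ≤ 2 ^ h * (s + 1 ∸ h)
    length-lowBridgeImage = ≤-trans (length-deduplicate _≟ₓ_ (cartesianProductWith f lows bridges))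
      (≤-reflexive (trans (length-cartesianProductWith f lows bridges) length-lows*bridges))

    lowBridgeImage-unique : Unique lowBridgeImage
    lowBridgeImage-unique = deduplicate-! _≟ₓ_ (cartesianProductWith f lows bridges)

  origin : V
  origin = replicate _ false

  Low-origin : Low origin
  Low-origin i _ = lookup-replicate i false

  1<1+s+t : 1 < suc (s + t)
  1<1+s+t = s≤s (≤-trans 1≤t (≤-trans t≤m m≤s+t))

  one : Pos
  one = fromℕ< 1<1+s+t

  toℕ-one : toℕ one ≡ 1
  toℕ-one = toℕ-fromℕ< 1<1+s+t

  one≤m : toℕ one ≤ m
  one≤m = subst (_≤ m) (sym toℕ-one) (≤-trans 1≤t t≤m)

  ¬Bridge-one : ¬ Bridge one
  ¬Bridge-one = ¬Bridge-low (≤-reflexive (sym toℕ-one)) (subst (_≤ t) (sym toℕ-one) 1≤t)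

  unit₁ : V
  unit₁ = flipBit origin one

  ¬Path-origin-unit₁ : ∀ {E : V → V → Set} → (∀ {u v} → E u v → Low u → Low v) → ¬ Path E origin unit₁
  ¬Path-origin-unit₁ closed path =
    ¬Low-flipBit-low origin Low-origin one≤m (Path-preserves Low closed path Low-origin)

  _≟V_ : DecidableEquality V
  _≟V_ = Vec.≡-dec Bool._≟_

  S : List V
  S = lowBridgeImage _≟V_ flipBit

  ∈S⇒singleLowOne : ∀ {v} → v ∈ S →
    ∃ λ r → Bridge r × lookup v r ≡ true × (∀ i → toℕ i ≤ m → i ≢ r → lookup v i ≡ false)
  ∈S⇒singleLowOne v∈ with ∈-lowBridgeImage⁻ _≟V_ flipBit v∈
  ... | w , r , low , bridge , refl =
    r , bridge , lookup-flipBit-low w low (Bridge⇒≤m bridge) ,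
    λ i i≤m i≢r → trans (lookup-flipBit-≢ w i≢r) (low i (s≤s i≤m))

  Low⇒∉S : ∀ {v} → Low v → v ∉ S
  Low⇒∉S low v∈ with ∈S⇒singleLowOne v∈
  ... | r , bridge , vr≡true , _ = contradiction (trans (sym vr≡true) (low r (s≤s (Bridge⇒≤m bridge)))) λ ()

  nonBridgeLowOne⇒∉S : ∀ {v i} → toℕ i ≤ m → ¬ Bridge i → lookup v i ≡ true → v ∉ S
  nonBridgeLowOne⇒∉S {i = i} i≤m ¬bridge vi≡true v∈ with ∈S⇒singleLowOne v∈
  ... | r , bridge , _ , others with i Fin.≟ r
  ...   | yes refl = ¬bridge bridge
  ...   | no i≢r   = contradiction (trans (sym vi≡true) (others i i≤m i≢r)) λ ()

  twoLowOnes⇒∉S : ∀ {v i j} → toℕ i ≤ m → toℕ j ≤ m → i ≢ j →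
    lookup v i ≡ true → lookup v j ≡ true → v ∉ S
  twoLowOnes⇒∉S {i = i} {j} i≤m j≤m i≢j vi≡true vj≡true v∈ with ∈S⇒singleLowOne v∈
  ... | r , _ , _ , others with i Fin.≟ r
  ...   | yes refl = contradiction (trans (sym vj≡true) (others j j≤m (i≢j ∘ sym))) λ ()
  ...   | no i≢r   = contradiction (trans (sym vi≡true) (others i i≤m i≢r)) λ ()

  ∈S-flipBit-high : ∀ {u r} → m < toℕ r → flipBit u r ∈ S → u ∈ S
  ∈S-flipBit-high {u} {r} m<r u′∈ with ∈-lowBridgeImage⁻ _≟V_ flipBit u′∈
  ... | w , b , low , bridge , u′≡ =
    subst (_∈ S) (sym u≡) (∈-lowBridgeImage⁺ _≟V_ flipBit (Low-flipBit-high w low m<r) bridge)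
    where
    open ≡-Reasoning
    u≡ : u ≡ flipBit (flipBit w r) b
    u≡ = begin
      u                        ≡⟨ flipBit-involutive u r ⟨
      flipBit (flipBit u r) r  ≡⟨ cong (λ x → flipBit x r) u′≡ ⟩
      flipBit (flipBit w b) r  ≡⟨ flipBit-comm w b r ⟩
      flipBit (flipBit w r) b  ∎

  ∉S⇒lowOne : ∀ {u} → lookup u Fin.zero ≡ true → u ∉ S →
    ∃ λ q → 1 ≤ toℕ q × toℕ q ≤ m × lookup u q ≡ true
  ∉S⇒lowOne {u} u₀ u∉S with any? (λ q → 1 ≤? toℕ q ×-dec toℕ q ≤? m ×-dec lookup u q Bool.≟ true)
  ... | yes lowOne = lowOne
  ... | no ∄lowOne = contradiction
    (subst (_∈ S) (flipBit-involutive u Fin.zero) (∈-lowBridgeImage⁺ _≟V_ flipBit low (inj₁ refl))) u∉S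
    where
    low : Low (flipBit u Fin.zero)
    low Fin.zero    _      = trans (lookup-flipBit u Fin.zero) (cong not u₀)
    low (Fin.suc i) i<1+m with lookup u (Fin.suc i) in ui
    ... | false = trans (lookup-flipBit-≢ u λ ()) ui
    ... | true  = contradiction (Fin.suc i , s≤s z≤n , s≤s⁻¹ i<1+m , ui) ∄lowOne

  G∖S : V → V → Set
  G∖S = DelVerts (EHAdj s t) S

  Low-closed-G∖S : ∀ {u v} → G∖S u v → Low u → Low v
  Low-closed-G∖S {u} {v} (adjacent , _ , v∉S) low with Low-edge {u} {v} low adjacent
  ... | inj₁ (r , bridge , refl) = contradiction (∈-lowBridgeImage⁺ _≟V_ flipBit {u} low bridge) v∉S
  ... | inj₂ low′                = low′

  degree-G∖S-high : ∀ {u} → u ∉ S → lookup u Fin.zero ≡ false → DegreeAtLeast G∖S h u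
  degree-G∖S-high {u} u∉S u₀ =
    degreeByFlips {G∖S} highPositions highPositions-unique h≤length-highPositions neighbour
    where
    neighbour : ∀ {r} → r ∈ highPositions → G∖S u (flipBit u r)
    neighbour r∈ with ∈-highPositions⁻ r∈
    ... | m<r = EHAdj-flipBit-high u u₀ (<-≤-trans (s≤s t≤m) m<r) , u∉S , u∉S ∘ ∈S-flipBit-high m<r

  degree-G∖S-lowOne : ∀ {u q} → u ∉ S → lookup u Fin.zero ≡ true →
    1 ≤ toℕ q → toℕ q ≤ t → lookup u q ≡ true → DegreeAtLeast G∖S h u
  degree-G∖S-lowOne {u} {q} u∉S u₀ 1≤q q≤t uq = degreeByFlips {G∖S} (without Fin._≟_ q positions)
    (without-unique Fin._≟_ q positions-unique) (≤-trans h≤t t≤length) neighbour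
    where
    1+t≤1+s+t : suc t ≤ suc (s + t)
    1+t≤1+s+t = s≤s (≤-trans t≤m m≤s+t)
    positions : List Pos
    positions = interval 0 (suc t) 1+t≤1+s+t
    positions-unique : Unique positions
    positions-unique = interval-unique 0 (suc t) 1+t≤1+s+t
    t≤length : t ≤ length (without Fin._≟_ q positions)
    t≤length = s≤s⁻¹ (subst (_≤ suc (length (without Fin._≟_ q positions)))
      (length-interval 0 (suc t) 1+t≤1+s+t) (length-without Fin._≟_ q positions-unique))
    neighbour : ∀ {r} → r ∈ without Fin._≟_ q positions → G∖S u (flipBit u r)
    neighbour {r} r∈ with ∈-without⁻ Fin._≟_ positions r∈
    ... | r∈′ , r≢q = adjacent , u∉S ,
      nonBridgeLowOne⇒∉S (≤-trans q≤t t≤m) (¬Bridge-low 1≤q q≤t) (trans (lookup-flipBit-≢ u (r≢q ∘ sym)) uq)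
      where
      r≤t : toℕ r ≤ t
      r≤t = s≤s⁻¹ (proj₂ (∈-interval⁻ _ _ _ r∈′))
      adjacent : EHAdj s t u (flipBit u r)
      adjacent with toℕ r ≟ 0
      ... | yes r≡0 = EHAdj-flipBit₀ u r≡0
      ... | no r≢0  = EHAdj-flipBit-low u u₀ (n≢0⇒n>0 r≢0) r≤t

  degree-G∖S-bridgeOne : ∀ {u q} → u ∉ S → lookup u Fin.zero ≡ true →
    t < toℕ q → toℕ q ≤ m → lookup u q ≡ true → DegreeAtLeast G∖S h u
  degree-G∖S-bridgeOne {u} {q} u∉S u₀ t<q q≤m uq =
    degreeByFlips {G∖S} lowPositions lowPositions-unique h≤length-lowPositions neighbour
    where
    neighbour : ∀ {r} → r ∈ lowPositions → G∖S u (flipBit u r)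
    neighbour {r} r∈ with ∈-lowPositions⁻ r∈
    ... | 1≤r , r≤t = EHAdj-flipBit-low u u₀ 1≤r r≤t , u∉S ,
      twoLowOnes⇒∉S z≤n q≤m (positive⇒≢zero (≤-trans (s≤s z≤n) t<q))
        (trans (lookup-flipBit-≢ u (positive⇒≢zero 1≤r)) u₀) (trans (lookup-flipBit-≢ u q≢r) uq)
      where
      q≢r : q ≢ r
      q≢r refl = <⇒≱ t<q r≤t

  degree-G∖S : ∀ u → u ∉ S → DegreeAtLeast G∖S h u
  degree-G∖S u u∉S with lookup u Fin.zero Bool.≟ true
  ... | no u₀≢true = degree-G∖S-high u∉S (¬-not u₀≢true)
  ... | yes u₀ with ∉S⇒lowOne u₀ u∉S
  ...   | q , 1≤q , q≤m , uq with toℕ q ≤? t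
  ...     | yes q≤t = degree-G∖S-lowOne u∉S u₀ 1≤q q≤t uq
  ...     | no q≰t  = degree-G∖S-bridgeOne u∉S u₀ (≰⇒> q≰t) q≤m uq

  isHVertexCut : IsHVertexCut (EHAdj s t) h S
  isHVertexCut =
      lowBridgeImage-unique _≟V_ flipBit
    , (origin , unit₁ , Low⇒∉S Low-origin ,
       nonBridgeLowOne⇒∉S one≤m ¬Bridge-one (lookup-flipBit-low origin Low-origin one≤m) ,
       ¬Path-origin-unit₁ Low-closed-G∖S)
    , degree-G∖S

  _≟E_ : DecidableEquality (V × V)
  _≟E_ = ≡-dec _≟V_ _≟V_

  bridgeEdge : V → Pos → V × V
  bridgeEdge w r = w , flipBit w r

  F : List (V × V)
  F = lowBridgeImage _≟E_ bridgeEdge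

  G∖F : V → V → Set
  G∖F = DelEdges (EHAdj s t) F

  EdgeIn-F⇒Bridge : ∀ {u r} → EdgeIn F u (flipBit u r) → Bridge r
  EdgeIn-F⇒Bridge {u} {r} (inj₁ e∈) with ∈-lowBridgeImage⁻ _≟E_ bridgeEdge e∈
  ... | w , b , _ , bridge , e≡ with ,-injective e≡
  ...   | refl , u′≡ = subst Bridge (sym (flipBit-injective u u′≡)) bridge
  EdgeIn-F⇒Bridge {u} {r} (inj₂ e∈) with ∈-lowBridgeImage⁻ _≟E_ bridgeEdge e∈
  ... | w , b , _ , bridge , e≡ with ,-injective e≡
  ...   | refl , u≡ = subst Bridge (sym (flipBit-injective (flipBit u r) r≡b)) bridge
    where
    r≡b : flipBit (flipBit u r) r ≡ flipBit (flipBit u r) b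
    r≡b = trans (flipBit-involutive u r) u≡

  Low-closed-G∖F : ∀ {u v} → G∖F u v → Low u → Low v
  Low-closed-G∖F {u} {v} (adjacent , ∉F) low with Low-edge {u} {v} low adjacent
  ... | inj₁ (r , bridge , refl) = contradiction (inj₁ (∈-lowBridgeImage⁺ _≟E_ bridgeEdge {u} low bridge)) ∉F
  ... | inj₂ low′                = low′

  degree-G∖F : ∀ u → DegreeAtLeast G∖F h u
  degree-G∖F u with lookup u Fin.zero Bool.≟ true
  ... | no u₀≢true = degreeByFlips {G∖F} highPositions highPositions-unique h≤length-highPositions
    λ r∈ → let m<r = ∈-highPositions⁻ r∈ in
      EHAdj-flipBit-high u (¬-not u₀≢true) (<-≤-trans (s≤s t≤m) m<r) , ¬Bridge-high m<r ∘ EdgeIn-F⇒Bridge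
  ... | yes u₀ = degreeByFlips {G∖F} lowPositions lowPositions-unique h≤length-lowPositions
    λ r∈ → let (1≤r , r≤t) = ∈-lowPositions⁻ r∈ in
      EHAdj-flipBit-low u u₀ 1≤r r≤t , ¬Bridge-low 1≤r r≤t ∘ EdgeIn-F⇒Bridge

  F-edges : All (λ e → EHAdj s t (proj₁ e) (proj₂ e)) F
  F-edges = All.tabulate edge
    where
    edge : ∀ {e} → e ∈ F → EHAdj s t (proj₁ e) (proj₂ e)
    edge e∈ with ∈-lowBridgeImage⁻ _≟E_ bridgeEdge e∈
    ... | w , r , low , bridge , refl = EHAdj-flipBit-bridge {w} low bridge

  F-outgoing : All (λ e → Low (proj₁ e) × ¬ Low (proj₂ e)) F
  F-outgoing = All.tabulate outgoing
    where
    outgoing : ∀ {e} → e ∈ F → Low (proj₁ e) × ¬ Low (proj₂ e)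
    outgoing e∈ with ∈-lowBridgeImage⁻ _≟E_ bridgeEdge e∈
    ... | w , r , low , bridge , refl = low , ¬Low-flipBit-low w low (Bridge⇒≤m bridge)

  isHEdgeCut : IsHEdgeCut (EHAdj s t) h F
  isHEdgeCut =
      F-edges
    , outgoing⇒¬SameEdge Low F-outgoing (lowBridgeImage-unique _≟E_ bridgeEdge)
    , (origin , unit₁ , ¬Path-origin-unit₁ Low-closed-G∖F)
    , degree-G∖F

lemma3p1 : (s t h : ℕ) → 1 ≤ s → s ≤ t → h ≤ s →
    KappaH≤ (EHAdj s t) h (2 ^ h * (s + 1 ∸ h)) ×
    LambdaH≤ (EHAdj s t) h (2 ^ h * (s + 1 ∸ h))
lemma3p1 s t h 1≤s s≤t h≤s =
    (S , isHVertexCut , length-lowBridgeImage _≟V_ flipBit)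
  , (F , isHEdgeCut , length-lowBridgeImage _≟E_ bridgeEdge)
  where open Construction s t h 1≤s s≤t h≤s
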